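{- There is an absolute constant $c>0$ such that for every positive integer $w$ and every integer $t\ge \operatorname{tow}(\lceil c w\rceil)$, every worker-task assignment function for $w$ workers and $t$ tasks has switching cost exactly $w$ (i.e. there exist two adjacent task multisets on which all $w$ workers change their assigned task).
   Context: $\operatorname{tow}(n)$ denotes a tower of twos of height $n$ ($\operatorname{tow}(1)=2$, $\operatorname{tow}(n+1)=2^{\operatorname{tow}(n)}$). A task multiset is a multiset $T$ of size $w$ with elements in $[t]$; $m_T(j)$ is the multiplicity of $j$. A worker-task assignment function $\phi$ assigns to every task multiset $T$ a map $\phi(T):[w]\to[t]$ with exactly $m_T(j)$ workers mapped to each $j$. Task multisets $T_1,T_2$ of size $w$ are adjacent if $|T_1\setminus T_2|=|T_2\setminus T_1|=1$ (multiset difference). The switching cost of $\phi$ is the maximum, over adjacent $T_1,T_2$, of the number of workers $i$ with $\phi(T_1)(i)\ne\phi(T_2)(i)$. -}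

module Defs where

open import Data.Nat using (ℕ; zero; suc; _^_; _∸_)
open import Data.Fin using (Fin; _≟_)
open import Data.Vec using (Vec; lookup; sum; zipWith)
open import Data.List using (length; filter)
open import Data.List.Base using (allFin)
open import Data.Product using (Σ; proj₁)
open import Relation.Binary.PropositionalEquality using (_≡_)
open import Data.Integer using (ℤ)
open import Data.Rational using (ℚ; _/_; ceiling)
import Data.Integer as ℤ

tow : ℕ → ℕ
tow zero = 1
tow (suc n) = 2 ^ tow n

-- A task multiset of size w with elements in [t] = Fin t,
-- represented by its multiplicity vector m (m_T(j) = lookup m j), summing to w.
TaskMultiset : (t w : ℕ) → Set
TaskMultiset t w = Σ (Vec ℕ t) (λ m → sum m ≡ w)

mult : ∀ {t w} → TaskMultiset t w → Fin t → ℕ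
mult T j = lookup (proj₁ T) j

countWorkers : ∀ {w t} → (Fin w → Fin t) → Fin t → ℕ
countWorkers {w} f j = length (filter (λ i → f i ≟ j) (allFin w))

diffSize : ∀ {t w} → TaskMultiset t w → TaskMultiset t w → ℕ
diffSize T₁ T₂ = sum (zipWith _∸_ (proj₁ T₁) (proj₁ T₂))

Adjacent : ∀ {t w} → TaskMultiset t w → TaskMultiset t w → Set
Adjacent T₁ T₂ = Σ (diffSize T₁ T₂ ≡ 1) (λ _ → diffSize T₂ T₁ ≡ 1)

AssignmentFunction : (w t : ℕ) → Set
AssignmentFunction w t =
  (T : TaskMultiset t w) → Σ (Fin w → Fin t) (λ f → ∀ j → countWorkers f j ≡ mult T j)

assign : ∀ {w t} → AssignmentFunction w t → TaskMultiset t w → Fin w → Fin t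
assign φ T = proj₁ (φ T)

ceilMul : ℚ → ℕ → ℤ
ceilMul c w = ceiling (c Data.Rational.* (ℤ.+ w / 1))

module Submission where

-- 1. A shift Ramsey lemma: if the lists of k+1 natural numbers are r-coloured
--    and n > Tw k r (a tower of k twos topped by r), then there are
--    x < m₁ < … < mₖ < y below n whose "left window" x ∷ ms and
--    "right window" ms ∷ʳ y get the same colour.  It is proved by induction
--    on k, recolouring a list by the set of colours of its one-point
--    extensions to the left.
-- 2. A list W of w tasks below t is a task multiset.  Colour it by the
--    position pattern of φ: which position of W each worker's task occupies.
--    These are (w+1)^w colours.
-- 3. For a monochromatic shift, the windows x ∷ ms and ms ∷ʳ y are adjacent
--    (they exchange x for y), and a worker keeping its task e would find e
--    at positions p+1 and p of the two windows, contradicting the equal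
--    patterns.  So every worker switches.
-- 4. Tw (w-1) ((w+1)^w) < tow (4w) = tow ⌈4 · w⌉, so c = 4 works.

open import Defs
open import Data.Nat using (ℕ; _≤_)
open import Data.Fin using (Fin)
open import Data.Product using (Σ; _×_)
open import Data.Rational using (ℚ; 0ℚ; _<_)
open import Relation.Binary.PropositionalEquality using (_≢_)
import Data.Integer as ℤ

open import Data.Nat using (zero; suc; _+_; _*_; _^_; _∸_; z≤n; s≤s; _≟_; NonZero) renaming (_<_ to _<ₙ_)
import Data.Nat.Properties as NP
open import Data.Nat.DivMod using (_mod_; _%_; m<n⇒m%n≡m; n%1≡0; n/1≡n)
open import Data.Nat.Coprimality using (1-coprimeTo) renaming (sym to coprime-sym)
open import Data.Nat.Tactic.RingSolver using (solve-∀)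
open import Algebra.Properties.CommutativeSemigroup NP.+-commutativeSemigroup using (interchange)
import Data.Fin as F
open import Data.Fin.Base using (toℕ; fromℕ<; funToFin; finToFun)
open import Data.Fin.Properties using (pigeonhole; any?; toℕ<n; toℕ-fromℕ<; finToFun-funToFin)
open import Data.Vec using (Vec; tabulate; sum; zipWith)
open import Data.Vec.Properties using (lookup∘tabulate; tabulate-cong)
open import Data.List using (List; []; _∷_; _∷ʳ_; length)
open import Data.List.Properties using (length-++)
open import Data.List.Relation.Unary.All using (All; []; _∷_) renaming (map to all-map)
open import Data.List.Relation.Unary.All.Properties using (∷ʳ⁻)
open import Data.List.Membership.Propositional.Properties using (∈-filter⁺; ∈-allFin; ∈-length)
open import Data.Product using (_,_; proj₁; proj₂)
open import Data.Unit using (⊤; tt)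
open import Data.Bool using (if_then_else_)
open import Relation.Nullary using (Dec; yes; no; does; contradiction)
open import Relation.Nullary.Decidable using (dec-true; dec-false)
open import Relation.Binary.PropositionalEquality
  using (_≡_; refl; sym; trans; cong; cong₂; subst; subst₂; module ≡-Reasoning)
open import Data.Rational using (mkℚ; ceiling; *<*) renaming (_/_ to _÷_; _*_ to _*ℚ_)
open import Data.Rational.Properties using (normalize-coprime)

funToFin-injective : ∀ {r m} (f g : Fin r → Fin m) → funToFin f ≡ funToFin g → ∀ i → f i ≡ g i
funToFin-injective f g eq i = begin
  f i                       ≡⟨ sym (finToFun-funToFin f i) ⟩
  finToFun (funToFin f) i   ≡⟨ cong (λ k → finToFun k i) eq ⟩
  finToFun (funToFin g) i   ≡⟨ finToFun-funToFin g i ⟩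
  g i                       ∎
  where open ≡-Reasoning

Tw : ℕ → ℕ → ℕ
Tw zero    r = r
Tw (suc k) r = Tw k (2 ^ r)

Ascending : ℕ → List ℕ → ℕ → Set
Ascending lo []       hi = ⊤
Ascending lo (x ∷ xs) hi = lo ≤ x × x <ₙ hi × Ascending (suc x) xs hi

headOr0 : List ℕ → ℕ
headOr0 []      = 0
headOr0 (x ∷ _) = x

ascending-head : ∀ {lo hi y} ms → Ascending lo (ms ∷ʳ y) hi → lo ≤ headOr0 (ms ∷ʳ y)
ascending-head []      (lo≤y , _) = lo≤y
ascending-head (m ∷ _) (lo≤m , _) = lo≤m

ascending-bounds : ∀ {lo hi} xs → Ascending lo xs hi → All (lo ≤_) xs × All (_<ₙ hi) xs
ascending-bounds []       _                    = [] , []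
ascending-bounds (x ∷ xs) (lo≤x , x<hi , rest) =
  let above , below = ascending-bounds xs rest
  in  (lo≤x ∷ all-map (λ x<z → NP.≤-trans lo≤x (NP.<⇒≤ x<z)) above) , (x<hi ∷ below)

record MonochromaticShift {r} (χ : List ℕ → Fin r) (k n : ℕ) : Set where
  constructor shift
  field
    first         : ℕ
    middle        : List ℕ
    final         : ℕ
    middle-length : length middle ≡ k
    ascending     : Ascending 0 (first ∷ (middle ∷ʳ final)) n
    same-colour   : χ (first ∷ middle) ≡ χ (middle ∷ʳ final)

bit : ∀ {P : Set} → Dec P → Fin 2
bit (yes _) = F.suc F.zero
bit (no _)  = F.zero

bit-yes : ∀ {P : Set} (d : Dec P) → P → bit d ≡ F.suc F.zero
bit-yes (yes _) _ = refl
bit-yes (no ¬p) p = contradiction p ¬p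

bit-yes⁻ : ∀ {P : Set} (d : Dec P) → bit d ≡ F.suc F.zero → P
bit-yes⁻ (yes p) _ = p
bit-yes⁻ (no _)  ()

-- The recolouring for the induction step: the set of colours c such that
-- some y below the head of as gives y ∷ as the colour c, as an element of Fin (2 ^ r).
module _ {r} (χ : List ℕ → Fin r) where

  extensionColours : List ℕ → Fin (2 ^ r)
  extensionColours as = funToFin (λ c → bit (any? (λ (y : Fin (headOr0 as)) → χ (toℕ y ∷ as) F.≟ c)))

  transfer-extension : ∀ as bs x → extensionColours as ≡ extensionColours bs → x <ₙ headOr0 bs →
                       Σ (Fin (headOr0 as)) λ y → χ (toℕ y ∷ as) ≡ χ (x ∷ bs)
  transfer-extension as bs x same x<h = bit-yes⁻ (realised as) (trans same-bit (bit-yes (realised bs) witness))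
    where
    realised : ∀ cs → Dec (Σ (Fin (headOr0 cs)) λ y → χ (toℕ y ∷ cs) ≡ χ (x ∷ bs))
    realised cs = any? (λ y → χ (toℕ y ∷ cs) F.≟ χ (x ∷ bs))
    same-bit : bit (realised as) ≡ bit (realised bs)
    same-bit = funToFin-injective _ _ same (χ (x ∷ bs))
    witness : Σ (Fin (headOr0 bs)) λ y → χ (toℕ y ∷ bs) ≡ χ (x ∷ bs)
    witness = fromℕ< x<h , cong (λ z → χ (z ∷ bs)) (toℕ-fromℕ< x<h)

-- Induction on k: the base case is the pigeonhole principle on singletons; in the
-- step, a monochromatic shift x ∷ ms ∷ʳ y for the extension colours extends to
-- z ∷ x ∷ ms ∷ʳ y with z ∷ x ∷ ms coloured like x ∷ ms ∷ʳ y.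
shiftRamsey : ∀ k r n → Tw k r <ₙ n → (χ : List ℕ → Fin r) → MonochromaticShift χ k n
shiftRamsey zero r n r<n χ with pigeonhole r<n (λ i → χ (toℕ i ∷ []))
... | i , j , i<j , same = shift (toℕ i) [] (toℕ j) refl (z≤n , toℕ<n i , i<j , toℕ<n j , tt) same
shiftRamsey (suc k) r n bound χ
  with shift x ms y len (_ , x<n , rest) same ← shiftRamsey k (2 ^ r) n bound (extensionColours χ)
  with z , colour ← transfer-extension χ (x ∷ ms) (ms ∷ʳ y) x same (ascending-head ms rest)
  = shift (toℕ z) (x ∷ ms) y (cong suc len) (z≤n , NP.<-trans (toℕ<n z) x<n , toℕ<n z , x<n , rest) colour

indicator : ℕ → ℕ → ℕ
indicator x e = if does (x ≟ e) then 1 else 0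

indicator-≢ : ∀ {x e} → x ≢ e → indicator x e ≡ 0
indicator-≢ {x} {e} x≢e rewrite dec-false (x ≟ e) x≢e = refl

indicator-monus : ∀ {x y} e → x ≢ y → indicator x e ∸ indicator y e ≡ indicator x e
indicator-monus {x} {y} e x≢y with x ≟ e
... | no x≢e   rewrite indicator-≢ x≢e = NP.0∸n≡0 (indicator y e)
... | yes refl rewrite indicator-≢ (λ y≡x → x≢y (sym y≡x)) = refl

occ : List ℕ → ℕ → ℕ
occ []       e = 0
occ (x ∷ xs) e = indicator x e + occ xs e

occ-∷ʳ : ∀ xs y e → occ (xs ∷ʳ y) e ≡ occ xs e + indicator y e
occ-∷ʳ []       y e = NP.+-comm (indicator y e) 0
occ-∷ʳ (x ∷ xs) y e = trans (cong (indicator x e +_) (occ-∷ʳ xs y e))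
                            (sym (NP.+-assoc (indicator x e) (occ xs e) (indicator y e)))

occ-absent : ∀ {e} xs → All (_≢ e) xs → occ xs e ≡ 0
occ-absent []       []            = refl
occ-absent (x ∷ xs) (x≢e ∷ rest) = cong₂ _+_ (indicator-≢ x≢e) (occ-absent xs rest)

occVec : ∀ t → List ℕ → Vec ℕ t
occVec t W = tabulate (λ j → occ W (toℕ j))

sum-tabulate-zero : ∀ t → sum (tabulate {n = t} (λ _ → 0)) ≡ 0
sum-tabulate-zero zero    = refl
sum-tabulate-zero (suc t) = sum-tabulate-zero t

sum-tabulate-+ : ∀ {t} (f g : Fin t → ℕ) →
                 sum (tabulate (λ j → f j + g j)) ≡ sum (tabulate f) + sum (tabulate g)
sum-tabulate-+ {zero}  f g = refl
sum-tabulate-+ {suc t} f g =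
  trans (cong (f F.zero + g F.zero +_) (sum-tabulate-+ (λ j → f (F.suc j)) (λ j → g (F.suc j))))
        (interchange (f F.zero) (g F.zero) _ _)

sum-indicator : ∀ {t} x → x <ₙ t → sum (tabulate {n = t} (λ j → indicator x (toℕ j))) ≡ 1
sum-indicator {suc t} zero    _         = cong suc (sum-tabulate-zero t)
sum-indicator {suc t} (suc x) (s≤s x<t) = sum-indicator x x<t

zipWith-tabulate : ∀ {t} (_⊕_ : ℕ → ℕ → ℕ) (f g : Fin t → ℕ) →
                   zipWith _⊕_ (tabulate f) (tabulate g) ≡ tabulate (λ j → f j ⊕ g j)
zipWith-tabulate {zero}  _⊕_ f g = refl
zipWith-tabulate {suc t} _⊕_ f g =
  cong (f F.zero ⊕ g F.zero ∷_) (zipWith-tabulate _⊕_ (λ j → f (F.suc j)) (λ j → g (F.suc j)))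
  where open Data.Vec using (_∷_)

sum-occVec : ∀ {t} W → All (_<ₙ t) W → sum (occVec t W) ≡ length W
sum-occVec {t} []       []          = sum-tabulate-zero t
sum-occVec {t} (x ∷ W) (x<t ∷ W<t) =
  trans (sum-tabulate-+ {t} (λ j → indicator x (toℕ j)) (λ j → occ W (toℕ j)))
        (cong₂ _+_ (sum-indicator x x<t) (sum-occVec W W<t))

exchange-difference : ∀ {t} (c : Fin t → ℕ) {x y} → x <ₙ t → x ≢ y →
  sum (zipWith _∸_ (tabulate (λ j → c j + indicator x (toℕ j)))
                   (tabulate (λ j → c j + indicator y (toℕ j)))) ≡ 1
exchange-difference {t} c {x} {y} x<t x≢y = begin
  sum (zipWith _∸_ (tabulate (λ j → c j + indicator x (toℕ j))) (tabulate (λ j → c j + indicator y (toℕ j))))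
    ≡⟨ cong sum (zipWith-tabulate _∸_ (λ j → c j + indicator x (toℕ j)) (λ j → c j + indicator y (toℕ j))) ⟩
  sum (tabulate (λ j → (c j + indicator x (toℕ j)) ∸ (c j + indicator y (toℕ j))))
    ≡⟨ cong sum (tabulate-cong cancel) ⟩
  sum (tabulate {n = t} (λ j → indicator x (toℕ j)))
    ≡⟨ sum-indicator x x<t ⟩
  1 ∎
  where
  open ≡-Reasoning
  cancel : ∀ j → (c j + indicator x (toℕ j)) ∸ (c j + indicator y (toℕ j)) ≡ indicator x (toℕ j)
  cancel j = trans (NP.[m+n]∸[m+o]≡n∸o (c j) _ _) (indicator-monus (toℕ j) x≢y)

exchange-adjacent : ∀ {t w} (T₁ T₂ : TaskMultiset t w) (c : Fin t → ℕ) {x y} →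
  proj₁ T₁ ≡ tabulate (λ j → c j + indicator x (toℕ j)) →
  proj₁ T₂ ≡ tabulate (λ j → c j + indicator y (toℕ j)) →
  x <ₙ t → y <ₙ t → x ≢ y → Adjacent T₁ T₂
exchange-adjacent (_ , _) (_ , _) c refl refl x<t y<t x≢y =
  exchange-difference c x<t x≢y , exchange-difference c y<t (λ y≡x → x≢y (sym y≡x))

-- The position of the first occurrence of e in a list (its length if e is absent).
firstIndex : List ℕ → ℕ → ℕ
firstIndex []       e = 0
firstIndex (x ∷ xs) e = if does (x ≟ e) then 0 else suc (firstIndex xs e)

firstIndex-here : ∀ x xs → firstIndex (x ∷ xs) x ≡ 0
firstIndex-here x xs rewrite dec-true (x ≟ x) refl = refl

firstIndex-there : ∀ {x e} xs → x ≢ e → firstIndex (x ∷ xs) e ≡ suc (firstIndex xs e)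
firstIndex-there {x} {e} xs x≢e rewrite dec-false (x ≟ e) x≢e = refl

firstIndex-≤ : ∀ xs e → firstIndex xs e ≤ length xs
firstIndex-≤ []       e = z≤n
firstIndex-≤ (x ∷ xs) e with x ≟ e
... | yes refl = NP.≤-trans (NP.≤-reflexive (firstIndex-here x xs)) z≤n
... | no x≢e   = NP.≤-trans (NP.≤-reflexive (firstIndex-there xs x≢e)) (s≤s (firstIndex-≤ xs e))

firstIndex-∷ʳ : ∀ xs y e → 1 ≤ occ xs e → firstIndex (xs ∷ʳ y) e ≡ firstIndex xs e
firstIndex-∷ʳ (x ∷ xs) y e e∈ with x ≟ e
... | yes refl = trans (firstIndex-here x (xs ∷ʳ y)) (sym (firstIndex-here x xs))
... | no x≢e   = begin
  firstIndex (x ∷ (xs ∷ʳ y)) e ≡⟨ firstIndex-there (xs ∷ʳ y) x≢e ⟩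
  suc (firstIndex (xs ∷ʳ y) e) ≡⟨ cong suc (firstIndex-∷ʳ xs y e e∈xs) ⟩
  suc (firstIndex xs e)        ≡⟨ sym (firstIndex-there xs x≢e) ⟩
  firstIndex (x ∷ xs) e        ∎
  where
  open ≡-Reasoning
  e∈xs : 1 ≤ occ xs e
  e∈xs = subst (1 ≤_) (cong (_+ occ xs e) (indicator-≢ x≢e)) e∈

shift-index : ∀ x ms y e → occ (ms ∷ʳ y) x ≡ 0 → 1 ≤ occ (x ∷ ms) e → 1 ≤ occ (ms ∷ʳ y) e →
              firstIndex (x ∷ ms) e ≡ suc (firstIndex (ms ∷ʳ y) e)
shift-index x ms y e x∉ e∈₁ e∈₂ = begin
  firstIndex (x ∷ ms) e        ≡⟨ firstIndex-there ms x≢e ⟩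
  suc (firstIndex ms e)        ≡⟨ cong suc (sym (firstIndex-∷ʳ ms y e e∈ms)) ⟩
  suc (firstIndex (ms ∷ʳ y) e) ∎
  where
  open ≡-Reasoning
  x≢e : x ≢ e
  x≢e refl = contradiction (subst (1 ≤_) x∉ e∈₂) (λ ())
  e∈ms : 1 ≤ occ ms e
  e∈ms = subst (1 ≤_) (cong (_+ occ ms e) (indicator-≢ x≢e)) e∈₁

mod-injective : ∀ {m k n} .{{_ : NonZero n}} → m <ₙ n → k <ₙ n → m mod n ≡ k mod n → m ≡ k
mod-injective {m} {k} {n} m<n k<n eq = begin
  m              ≡⟨ sym (m<n⇒m%n≡m m<n) ⟩
  m % n          ≡⟨ sym (toℕ-fromℕ< _) ⟩
  toℕ (m mod n)  ≡⟨ cong toℕ eq ⟩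
  toℕ (k mod n)  ≡⟨ toℕ-fromℕ< _ ⟩
  k % n          ≡⟨ m<n⇒m%n≡m k<n ⟩
  k              ∎
  where open ≡-Reasoning

task-occurs : ∀ {w t} (φ : AssignmentFunction w t) T i → 1 ≤ mult T (assign φ T i)
task-occurs φ T i = subst (1 ≤_) (proj₂ (φ T) (assign φ T i))
  (∈-length (∈-filter⁺ (λ k → assign φ T k F.≟ assign φ T i) (∈-allFin i) refl))

module _ {w t} (φ : AssignmentFunction w t) where

  workerPositions : (W : List ℕ) → sum (occVec t W) ≡ w → Fin w → Fin (suc w)
  workerPositions W p i = firstIndex W (toℕ (assign φ (occVec t W , p) i)) mod suc w

  positionPattern : (W : List ℕ) → sum (occVec t W) ≡ w → Fin (suc w ^ w)
  positionPattern W p = funToFin (workerPositions W p)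

  colouring : List ℕ → Fin (suc w ^ w)
  colouring W with sum (occVec t W) ≟ w
  ... | yes p = positionPattern W p
  ... | no _  = funToFin {w} {suc w} (λ _ → F.zero)

  colouring-pattern : ∀ W (p : sum (occVec t W) ≡ w) → colouring W ≡ positionPattern W p
  colouring-pattern W p with sum (occVec t W) ≟ w
  ... | yes q = cong (positionPattern W) (NP.≡-irrelevant q p)
  ... | no ¬q = contradiction p ¬q

  task-occurs-in : ∀ W (p : sum (occVec t W) ≡ w) i → 1 ≤ occ W (toℕ (assign φ (occVec t W , p) i))
  task-occurs-in W p i =
    subst (1 ≤_) (lookup∘tabulate (λ j → occ W (toℕ j)) (assign φ (occVec t W , p) i)) (task-occurs φ (occVec t W , p) i)

-- If the windows x ∷ ms and ms ∷ʳ y (with x ∉ ms ∷ʳ y) have equal position patterns,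
-- every worker changes task: a kept task e would sit at positions p+1 and p.
patterns⇒switch : ∀ {w' t} (φ : AssignmentFunction (suc w') t) x ms y →
  length ms ≡ w' → occ (ms ∷ʳ y) x ≡ 0 →
  (p₁ : sum (occVec t (x ∷ ms)) ≡ suc w') (p₂ : sum (occVec t (ms ∷ʳ y)) ≡ suc w') →
  positionPattern φ (x ∷ ms) p₁ ≡ positionPattern φ (ms ∷ʳ y) p₂ →
  (i : Fin (suc w')) → assign φ (occVec t (x ∷ ms) , p₁) i ≢ assign φ (occVec t (ms ∷ʳ y) , p₂) i
patterns⇒switch {w'} {t} φ x ms y len x∉W₂ p₁ p₂ patterns i keeps =
  NP.1+n≢n (mod-injective (s≤s p+1≤w) (NP.m≤n⇒m≤1+n p+1≤w) same-position)
  where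
  W₁ = x ∷ ms
  W₂ = ms ∷ʳ y
  w = suc w'
  e = toℕ (assign φ (occVec t W₁ , p₁) i)
  p = firstIndex W₂ e
  shifted : firstIndex W₁ e ≡ suc p
  shifted = shift-index x ms y e x∉W₂ (task-occurs-in φ W₁ p₁ i)
              (subst (λ f → 1 ≤ occ W₂ (toℕ f)) (sym keeps) (task-occurs-in φ W₂ p₂ i))
  p+1≤w : suc p ≤ w
  p+1≤w = subst₂ _≤_ shifted (cong suc len) (firstIndex-≤ W₁ e)
  same-position : suc p mod suc w ≡ p mod suc w
  same-position = subst₂ (λ a f → a mod suc w ≡ firstIndex W₂ (toℕ f) mod suc w) shifted (sym keeps)
                    (funToFin-injective (workerPositions φ W₁ p₁) (workerPositions φ W₂ p₂) patterns i)

FullSwitch : ∀ {w t} → AssignmentFunction w t → Set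
FullSwitch {w} {t} φ = Σ (TaskMultiset t w) λ T₁ → Σ (TaskMultiset t w) λ T₂ →
                       Adjacent T₁ T₂ × ((i : Fin w) → assign φ T₁ i ≢ assign φ T₂ i)

-- A monochromatic shift x ∷ ms ∷ʳ y of the position-pattern colouring gives a full
-- switch: the windows are task multisets exchanging x for y, and their equal colours
-- are equal position patterns.
shift⇒fullSwitch : ∀ {w' t} (φ : AssignmentFunction (suc w') t) →
                   MonochromaticShift (colouring φ) w' t → FullSwitch φ
shift⇒fullSwitch {w'} {t} φ (shift x ms y len (_ , x<t , ascending) same) = T₁ , T₂ , adjacent , switches
  where
  w = suc w'
  W₁ = x ∷ ms
  W₂ = ms ∷ʳ y
  above-x : All (suc x ≤_) W₂
  above-x = proj₁ (ascending-bounds W₂ ascending)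
  W₂<t : All (_<ₙ t) W₂
  W₂<t = proj₂ (ascending-bounds W₂ ascending)
  x∉W₂ : occ W₂ x ≡ 0
  x∉W₂ = occ-absent W₂ (all-map (λ x<z z≡x → NP.<⇒≢ x<z (sym z≡x)) above-x)
  sum₁ : sum (occVec t W₁) ≡ w
  sum₁ = trans (sum-occVec W₁ (x<t ∷ proj₁ (∷ʳ⁻ W₂<t))) (cong suc len)
  sum₂ : sum (occVec t W₂) ≡ w
  sum₂ = trans (sum-occVec W₂ W₂<t) (trans (length-++ ms) (trans (NP.+-comm (length ms) 1) (cong suc len)))
  T₁ T₂ : TaskMultiset t w
  T₁ = occVec t W₁ , sum₁
  T₂ = occVec t W₂ , sum₂
  adjacent : Adjacent T₁ T₂
  adjacent = exchange-adjacent T₁ T₂ (λ j → occ ms (toℕ j))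
    (tabulate-cong (λ j → NP.+-comm (indicator x (toℕ j)) (occ ms (toℕ j))))
    (tabulate-cong (λ j → occ-∷ʳ ms y (toℕ j)))
    x<t (proj₂ (∷ʳ⁻ W₂<t)) (NP.<⇒≢ (proj₂ (∷ʳ⁻ above-x)))

  switches : (i : Fin w) → assign φ T₁ i ≢ assign φ T₂ i
  switches = patterns⇒switch φ x ms y len x∉W₂ sum₁ sum₂
    (trans (sym (colouring-pattern φ W₁ sum₁)) (trans same (colouring-pattern φ W₂ sum₂)))

n<2^n : ∀ n → n <ₙ 2 ^ n
n<2^n zero    = s≤s z≤n
n<2^n (suc n) = begin-strict
  suc n          ≤⟨ n<2^n n ⟩
  2 ^ n          <⟨ NP.m<m+n (2 ^ n) (NP.m^n>0 2 n) ⟩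
  2 ^ n + 2 ^ n  ≡⟨ cong (2 ^ n +_) (sym (NP.+-identityʳ (2 ^ n))) ⟩
  2 ^ suc n      ∎
  where open NP.≤-Reasoning

2^-mono-< : ∀ {m n} → m <ₙ n → 2 ^ m <ₙ 2 ^ n
2^-mono-< = NP.^-monoʳ-< 2 (s≤s (s≤s z≤n))

n<tow : ∀ n → n <ₙ tow n
n<tow zero    = s≤s z≤n
n<tow (suc n) = NP.<-≤-trans (s≤s (n<tow n)) (n<2^n (tow n))

tow-mono : ∀ {m n} → m ≤ n → tow m ≤ tow n
tow-mono {zero}  {zero}  _         = NP.≤-refl
tow-mono {zero}  {suc n} _         = NP.m^n>0 2 (tow n)
tow-mono {suc m} {suc n} (s≤s m≤n) = NP.^-monoʳ-≤ 2 (tow-mono m≤n)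

-- Tw k is k further exponentiations, so it climbs the tower k storeys.
Tw-below-tow : ∀ k {r} M → r <ₙ tow M → Tw k r <ₙ tow (k + M)
Tw-below-tow zero    M r<tow = r<tow
Tw-below-tow (suc k) {r} M r<tow =
  subst (λ n → Tw k (2 ^ r) <ₙ tow n) (NP.+-suc k M) (Tw-below-tow k (suc M) (2^-mono-< r<tow))

patterns-below-tow : ∀ w → suc w ^ w <ₙ tow (2 + (w + w))
patterns-below-tow w = begin-strict
  suc w ^ w          ≤⟨ NP.^-monoˡ-≤ w (n<2^n w) ⟩
  (2 ^ w) ^ w        ≡⟨ NP.^-*-assoc 2 w w ⟩
  2 ^ (w * w)        <⟨ 2^-mono-< w*w<tow ⟩
  tow (2 + (w + w))  ∎
  where
  open NP.≤-Reasoning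
  w*w<tow : w * w <ₙ tow (1 + (w + w))
  w*w<tow = begin-strict
    w * w              ≤⟨ NP.*-mono-≤ (NP.<⇒≤ (n<2^n w)) (NP.<⇒≤ (n<2^n w)) ⟩
    2 ^ w * 2 ^ w      ≡⟨ sym (NP.^-distribˡ-+-* 2 w w) ⟩
    2 ^ (w + w)        <⟨ 2^-mono-< (n<tow (w + w)) ⟩
    tow (1 + (w + w))  ∎

ramsey-threshold : ∀ w' → Tw w' (suc (suc w') ^ suc w') <ₙ tow (4 * suc w')
ramsey-threshold w' = NP.<-≤-trans (Tw-below-tow w' _ (patterns-below-tow (suc w'))) (tow-mono storeys)
  where
  storeys-identity : ∀ n → 4 * suc n ≡ (n + (2 + (suc n + suc n))) + n
  storeys-identity = solve-∀
  storeys : w' + (2 + (suc w' + suc w')) ≤ 4 * suc w'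
  storeys = subst (w' + (2 + (suc w' + suc w')) ≤_) (sym (storeys-identity w')) (NP.m≤m+n _ w')

four : ℚ
four = ℤ.+ 4 ÷ 1

0<four : 0ℚ < four
0<four = *<* (ℤ.+<+ (s≤s z≤n))

integerℚ : ℕ → ℚ
integerℚ n = mkℚ (ℤ.+ n) 0 (coprime-sym (1-coprimeTo n))

n÷1≡integerℚ : ∀ n → ℤ.+ n ÷ 1 ≡ integerℚ n
n÷1≡integerℚ n = normalize-coprime _

ceiling-integerℚ : ∀ n → ℤ.∣ ceiling (integerℚ n) ∣ ≡ n
ceiling-integerℚ zero    = refl
ceiling-integerℚ (suc m) rewrite n%1≡0 (suc m) | n/1≡n (suc m) | NP.+-identityʳ m = refl

ceilMul-four : ∀ w → ℤ.∣ ceilMul four (suc w) ∣ ≡ 4 * suc w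
ceilMul-four w = begin
  ℤ.∣ ceiling (four *ℚ (ℤ.+ suc w ÷ 1)) ∣ ≡⟨ cong (λ q → ℤ.∣ ceiling (four *ℚ q) ∣) (n÷1≡integerℚ (suc w)) ⟩
  ℤ.∣ ceiling (ℤ.+ (4 * suc w) ÷ 1) ∣     ≡⟨ cong (λ q → ℤ.∣ ceiling q ∣) (n÷1≡integerℚ (4 * suc w)) ⟩
  ℤ.∣ ceiling (integerℚ (4 * suc w)) ∣    ≡⟨ ceiling-integerℚ (4 * suc w) ⟩
  4 * suc w                               ∎
  where open ≡-Reasoning

theorem3 : Σ ℚ (λ c → (0ℚ < c) ×
             ((w : ℕ) → 1 ≤ w → (t : ℕ) → tow (ℤ.∣ ceilMul c w ∣) ≤ t →
              (φ : AssignmentFunction w t) →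
              Σ (TaskMultiset t w) (λ T₁ → Σ (TaskMultiset t w) (λ T₂ →
                Adjacent T₁ T₂ × ((i : Fin w) → assign φ T₁ i ≢ assign φ T₂ i)))))
theorem3 = four , 0<four , fullSwitch
  where
  fullSwitch : (w : ℕ) → 1 ≤ w → (t : ℕ) → tow (ℤ.∣ ceilMul four w ∣) ≤ t →
               (φ : AssignmentFunction w t) → FullSwitch φ
  fullSwitch zero    ()
  fullSwitch (suc w') _ t t-large φ = shift⇒fullSwitch φ (shiftRamsey w' _ t enough-tasks (colouring φ))
    where
    enough-tasks : Tw w' (suc (suc w') ^ suc w') <ₙ t
    enough-tasks = NP.<-≤-trans (ramsey-threshold w') (subst (λ n → tow n ≤ t) (ceilMul-four w') t-large)
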